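{- (i) (Clopen Ramsey Theorem) For every stump $U$ and all sets $A,B\subseteq\overline{U}$ of finite sequences, if $A$ and $B$ are both almost-full, then $A\cap B$ is almost-full. (ii) (Infinite Ramsey Theorem) For every $k\in\mathbb{N}$ and all $A,B\subseteq[\omega]^k$, if $A$ and $B$ are both almost-full, then $A\cap B$ is almost-full.
   Context: The setting is intuitionistic mathematics (logical constants read constructively), in which Brouwer's Thesis on bars in $\mathcal{N}$ is accepted (for every set $B$ of finite sequences such that every $\alpha\in\mathcal{N}$ has an initial segment in $B$, there is a stump $S$ such that every $\alpha$ has an initial segment in $S\cap B$), as well as the principle of induction on stumps (if a property holds of $\emptyset$, and holds of a nonempty stump $S$ whenever it holds of all $S\upharpoonright\langle n\rangle=\{s\mid\langle n\rangle\ast s\in S\}$, then it holds of all stumps). $\mathcal{N}$ is the set of infinite sequences of natural numbers; finite sequences are coded by natural numbers; $\langle\,\rangle$ is the empty sequence, $\ast$ concatenation; for finite sequences $s\sqsubset t$ means $s$ is a proper initial segment of $t$. $[\omega]^\omega$ is the set of strictly increasing $\zeta\in\mathcal{N}$; $[\omega]^k$ the set of strictly increasing finite sequences of length $k$; $[\omega]^{<\omega}=\bigcup_k[\omega]^k$. For $\zeta\in\mathcal{N}$ and finite $s$ of length $k$, $\zeta\circ s$ is the sequence of length $k$ with $(\zeta\circ s)(i)=\zeta(s(i))$. A set $A$ of finite sequences is almost-full iff $\forall\zeta\in[\omega]^\omega\exists s\in[\omega]^{<\omega}[\zeta\circ s\in A]$. Stumps are generated inductively: $\emptyset$ is a stump;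 if $S_0,S_1,\ldots$ are stumps then $\{\langle\,\rangle\}\cup\bigcup_n\{\langle n\rangle\ast t\mid t\in S_n\}$ is a stump; nothing else. The border of a stump $U$ is $\overline{U}=\{s\mid s\notin U\wedge\forall t\sqsubset s[t\in U]\}$. -}

module Defs where

open import Data.Nat using (ℕ; zero; suc; _<_)
open import Data.List using (List; []; _∷_; _++_; map; length)
open import Data.List.Relation.Unary.Linked using (Linked)
open import Data.Product using (Σ; _×_; _,_)
open import Data.Empty using (⊥)
open import Data.Unit using (⊤)
open import Relation.Nullary using (¬_)
open import Relation.Binary.PropositionalEquality using (_≡_)

-- Finite sequences of natural numbers (the paper codes them by naturals).
Seq : Set
Seq = List ℕ

SeqSet : Set₁
SeqSet = Seq → Set

Baire : Set
Baire = ℕ → ℕ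

initSeg : Baire → ℕ → Seq
initSeg α zero    = []
initSeg α (suc n) = α 0 ∷ initSeg (λ i → α (suc i)) n

_⊏_ : Seq → Seq → Set
s ⊏ t = Σ ℕ λ x → Σ Seq λ u → s ++ (x ∷ u) ≡ t

-- Stumps, generated inductively (∅, and ⟨⟩ ∪ ⋃ₙ ⟨n⟩ ∗ Sₙ).
data Stump : Set where
  ∅    : Stump
  node : (ℕ → Stump) → Stump

_∈S_ : Seq → Stump → Set
s       ∈S ∅      = ⊥
[]      ∈S node f = ⊤
(n ∷ s) ∈S node f = s ∈S f n

Border : Stump → SeqSet
Border U s = ¬ (s ∈S U) × (∀ t → t ⊏ s → t ∈S U)

_⊆_ : SeqSet → SeqSet → Set
A ⊆ B = ∀ s → A s → B s

_∩_ : SeqSet → SeqSet → SeqSet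
(A ∩ B) s = A s × B s

StrictInc : Baire → Set
StrictInc ζ = ∀ i → ζ i < ζ (suc i)

IncSeq : Seq → Set
IncSeq s = Linked _<_ s

IncSeqLen : ℕ → SeqSet
IncSeqLen k s = IncSeq s × length s ≡ k

_∘s_ : Baire → Seq → Seq
ζ ∘s s = map ζ s

AlmostFull : SeqSet → Set
AlmostFull A = (ζ : Baire) → StrictInc ζ → Σ Seq λ s → IncSeq s × A (ζ ∘s s)

-- Brouwer's Thesis on bars in 𝒩 (accepted axiom of the setting).
BrouwersThesis : Set₁
BrouwersThesis =
  (B : SeqSet) → (∀ (α : Baire) → Σ ℕ λ n → B (initSeg α n)) →
  Σ Stump λ S → ∀ (α : Baire) → Σ ℕ λ n → (initSeg α n ∈S S) × B (initSeg α n)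

ClopenRamsey : Set₁
ClopenRamsey =
  (U : Stump) (A B : SeqSet) → A ⊆ Border U → B ⊆ Border U →
  AlmostFull A → AlmostFull B → AlmostFull (A ∩ B)

InfiniteRamsey : Set₁
InfiniteRamsey =
  (k : ℕ) (A B : SeqSet) → A ⊆ IncSeqLen k → B ⊆ IncSeqLen k →
  AlmostFull A → AlmostFull B → AlmostFull (A ∩ B)

-- Almost-fullness is recast inductively (AF): C is AF above m if ⟨⟩ ∈ C or if, for every
-- next entry a ≥ m, the set {s | s ∈ C ∨ a ∷ s ∈ C} is AF above a + 1.  An AF derivation
-- yields almost-fullness directly.  Conversely, reading α ∈ 𝒩 as the gaps of a strictly
-- increasing sequence turns an almost-full C into a bar in 𝒩, and the stump that Brouwer's
-- Thesis gives for this bar is the skeleton of an AF derivation.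
-- For A, B in the border of U and any R: if R ∪ A and R ∪ B are AF, so is R ∪ (A ∩ B), by
-- induction on U and on both derivations.  If ⟨⟩ ∈ A then U = ∅ and B ⊆ A.  When both
-- derivations step to a, the inner inductions make R′ ∪ A ↾ a ∪ (A ∩ B) and
-- R′ ∪ B ↾ a ∪ (A ∩ B) AF (R′ the extension of R by a), and the outer induction, applied to
-- A ↾ a and B ↾ a in the border of U ↾ ⟨a⟩, combines the two.
-- Part (ii) is part (i) for the stump of sequences shorter than k, whose border is the
-- sequences of length k.
module Submission where

open import Defs
open import Data.Empty using (⊥-elim)
open import Data.List using ([]; _∷_; map; length)
open import Data.List.Properties using (map-∘; length-++)
open import Data.List.Extrema.Nat using (max; xs≤max)
open import Data.List.Relation.Unary.All as All using (All; []; _∷_)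
import Data.List.Relation.Unary.All.Properties as All
import Data.List.Relation.Unary.AllPairs as AllPairs
open import Data.List.Relation.Unary.Linked as Linked using ([]; [-]; _∷_)
import Data.List.Relation.Unary.Linked.Properties as Linked
open import Data.Nat using (ℕ; zero; suc; _+_; _∸_; _≤_; _<_; z≤n; s≤s; s<s; s<s⁻¹; z<s)
open import Data.Nat.Properties using (≤-trans; <-trans; m≤n⇒m≤1+n; m≤m+n; m<m+n; m+[n∸m]≡n; suc-injective)
open import Data.Product using (Σ; ∃; _×_; _,_; -,_; proj₁; proj₂; map₁; map₂)
open import Data.Sum using (_⊎_; inj₁; inj₂)
open import Data.Unit using (tt)
open import Relation.Nullary using (¬_; contradiction)
open import Relation.Unary using () renaming (∅ to ∅ᵘ)
open import Relation.Binary.PropositionalEquality using (_≡_; refl; sym; subst; cong)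

infixl 21 _∪_
infixl 22 _↾_

_∪_ : SeqSet → SeqSet → SeqSet
(C ∪ D) s = C s ⊎ D s

_↾_ : SeqSet → ℕ → SeqSet
(C ↾ a) s = C (a ∷ s)

extend : ℕ → SeqSet → SeqSet
extend a C = C ∪ C ↾ a

∅-∪ : ∀ {C} → ∅ᵘ ∪ C ⊆ C
∅-∪ _ (inj₂ c) = c

∪-monoʳ : ∀ {C D E} → D ⊆ E → C ∪ D ⊆ C ∪ E
∪-monoʳ _   _ (inj₁ c) = inj₁ c
∪-monoʳ D⊆E s (inj₂ d) = inj₂ (D⊆E s d)

∪-swap : ∀ {C D E} → C ∪ D ∪ E ⊆ C ∪ E ∪ D
∪-swap _ (inj₁ (inj₁ c)) = inj₁ (inj₁ c)
∪-swap _ (inj₁ (inj₂ d)) = inj₂ d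
∪-swap _ (inj₂ e)        = inj₁ (inj₂ e)

extend-mono : ∀ {a C D} → C ⊆ D → extend a C ⊆ extend a D
extend-mono     C⊆D s (inj₁ c) = inj₁ (C⊆D s c)
extend-mono {a} C⊆D s (inj₂ c) = inj₂ (C⊆D (a ∷ s) c)

∪-extend : ∀ {a C D E} → C ∪ D ⊆ extend a C ∪ E ∪ D
∪-extend _ (inj₁ c) = inj₁ (inj₁ (inj₁ c))
∪-extend _ (inj₂ d) = inj₂ d

extend-∪ : ∀ {a C D} → extend a (C ∪ D) ⊆ extend a C ∪ D ↾ a ∪ D
extend-∪ _ (inj₁ (inj₁ c)) = inj₁ (inj₁ (inj₁ c))
extend-∪ _ (inj₁ (inj₂ d)) = inj₂ d
extend-∪ _ (inj₂ (inj₁ c)) = inj₁ (inj₁ (inj₂ c))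
extend-∪ _ (inj₂ (inj₂ d)) = inj₁ (inj₂ d)

extend-∪⁻ : ∀ {a C D} → extend a C ∪ D ∪ D ↾ a ⊆ extend a (C ∪ D)
extend-∪⁻ _ (inj₁ (inj₁ (inj₁ c))) = inj₁ (inj₁ c)
extend-∪⁻ _ (inj₁ (inj₁ (inj₂ c))) = inj₂ (inj₁ c)
extend-∪⁻ _ (inj₁ (inj₂ d))        = inj₁ (inj₂ d)
extend-∪⁻ _ (inj₂ d)               = inj₂ (inj₂ d)

-- The stump bounds the derivation; since weakening (AF-⊆, AF-raise) keeps the stump,
-- it serves as the induction measure in the proof of intersect.
data AF (m : ℕ) (C : SeqSet) : Stump → Set where
  now   : ∀ {S} → C [] → AF m C S
  later : ∀ {h} → (∀ a → m ≤ a → AF (suc a) (extend a C) (h a)) → AF m C (node h)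

AF-⊆ : ∀ {m C D S} → C ⊆ D → AF m C S → AF m D S
AF-⊆ C⊆D (now c)   = now (C⊆D [] c)
AF-⊆ C⊆D (later f) = later λ a m≤a → AF-⊆ (extend-mono C⊆D) (f a m≤a)

AF-raise : ∀ {m m′ C S} → m ≤ m′ → AF m C S → AF m′ C S
AF-raise _     (now c)   = now c
AF-raise m≤m′ (later f) = later λ a m′≤a → f a (≤-trans m≤m′ m′≤a)

∃AF-later : ∀ {m C} → (∀ d → ∃ (AF (suc (m + d)) (extend (m + d) C))) → ∃ (AF m C)
∃AF-later {m} {C} f = node (λ a → proj₁ (f (a ∸ m))) , later λ a m≤a →
  subst (λ x → AF (suc x) (extend x C) (proj₁ (f (a ∸ m)))) (m+[n∸m]≡n m≤a) (proj₂ (f (a ∸ m)))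

shift-inc : ∀ {s} → IncSeq s → IncSeq (map suc s)
shift-inc inc = Linked.map⁺ (Linked.map s<s inc)

shift-inc⁻ : ∀ {s} → IncSeq (map suc s) → IncSeq s
shift-inc⁻ inc = Linked.map s<s⁻¹ (Linked.map⁻ inc)

zero∷shift-inc : ∀ {s} → IncSeq s → IncSeq (0 ∷ map suc s)
zero∷shift-inc {[]}    _   = [-]
zero∷shift-inc {_ ∷ _} inc = z<s ∷ shift-inc inc

shift-below⁻ : ∀ {n s} → All (_< suc n) (map suc s) → All (_< n) s
shift-below⁻ below = All.map s<s⁻¹ (All.map⁻ below)

inc-tail : ∀ {x s} → IncSeq (x ∷ s) → IncSeq s
inc-tail [-]       = []
inc-tail (_ ∷ inc) = inc

AF-sound : ∀ {m C S} → AF m C S → ∀ ζ → StrictInc ζ → m ≤ ζ 0 →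
           Σ Seq λ s → IncSeq s × C (ζ ∘s s)
AF-sound (now c) _ _ _ = [] , [] , c
AF-sound {C = C} (later f) ζ ζ-inc m≤ζ₀
  with AF-sound (f (ζ 0) m≤ζ₀) (λ i → ζ (suc i)) (λ i → ζ-inc (suc i)) (ζ-inc 0)
... | s , inc , inj₁ c = map suc s , shift-inc inc , subst C (map-∘ s) c
... | s , inc , inj₂ c = 0 ∷ map suc s , zero∷shift-inc inc , subst (λ w → C (ζ 0 ∷ w)) (map-∘ s) c

AF⇒almostFull : ∀ {C S} → AF 0 C S → AlmostFull C
AF⇒almostFull af ζ ζ-inc = AF-sound af ζ ζ-inc z≤n

cons : ℕ → Baire → Baire
cons d α zero    = d
cons d α (suc i) = α i

fromGaps : ℕ → Baire → Baire
fromGaps m α zero    = m + α 0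
fromGaps m α (suc i) = fromGaps (suc (m + α 0)) (λ i → α (suc i)) i

fromGaps-inc : ∀ m α → StrictInc (fromGaps m α)
fromGaps-inc m α zero    = s≤s (m≤m+n (m + α 0) (α 1))
fromGaps-inc m α (suc i) = fromGaps-inc (suc (m + α 0)) (λ i → α (suc i)) i

FullAfter : ℕ → SeqSet → Seq → Set
FullAfter m C []      = C []
FullAfter m C (d ∷ u) = FullAfter (suc (m + d)) (extend (m + d) C) u

positive⇒shift : ∀ {s} → All (0 <_) s → Σ Seq λ s′ → s ≡ map suc s′
positive⇒shift [] = [] , refl
positive⇒shift {zero ∷ _} (() ∷ _)
positive⇒shift {suc x ∷ _} (_ ∷ ps) with positive⇒shift ps
... | s′ , refl = x ∷ s′ , refl

zero-or-shift : ∀ {s} → IncSeq s → Σ Seq λ s′ → s ≡ map suc s′ ⊎ s ≡ 0 ∷ map suc s′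
zero-or-shift {[]} _ = [] , inj₁ refl
zero-or-shift {zero ∷ _} inc with positive⇒shift (AllPairs.head (Linked.Linked⇒AllPairs <-trans inc))
... | s′ , refl = s′ , inj₂ refl
zero-or-shift {suc _ ∷ _} inc = map₂ inj₁ (positive⇒shift (Linked.Linked⇒All <-trans z<s inc))

full-after : ∀ n {m C α s} → IncSeq s → All (_< n) s → C (fromGaps m α ∘s s) →
             FullAfter m C (initSeg α n)
full-after zero {s = []} _ _ c = c
full-after zero {s = _ ∷ _} _ (() ∷ _) _
full-after (suc n) {m} {C} {α} inc below c with zero-or-shift inc
... | s′ , inj₁ refl =
  full-after n (shift-inc⁻ inc) (shift-below⁻ below) (inj₁ (subst C (sym (map-∘ s′)) c))
... | s′ , inj₂ refl =
  full-after n (shift-inc⁻ (inc-tail inc)) (shift-below⁻ (All.tail below))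
    (inj₂ (subst (λ w → C (m + α 0 ∷ w)) (sym (map-∘ s′)) c))

almostFull⇒bar : ∀ {C} → AlmostFull C → ∀ α → Σ ℕ λ n → FullAfter 0 C (initSeg α n)
almostFull⇒bar af α with af (fromGaps 0 α) (fromGaps-inc 0 α)
... | s , inc , c = suc (max 0 s) , full-after (suc (max 0 s)) inc (All.map s≤s (xs≤max 0 s)) c

-- The empty segment is admitted even when T = ∅, so that the condition passes to T ↾ ⟨d⟩.
BarredBy : Stump → ℕ → SeqSet → Set
BarredBy T m C = ∀ α → Σ ℕ λ n → (n ≡ 0 ⊎ initSeg α n ∈S T) × FullAfter m C (initSeg α n)

barred⇒AF : ∀ T {m C} → BarredBy T m C → ∃ (AF m C)
barred⇒AF ∅ bar with bar (λ _ → 0)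
... | _ , inj₁ refl , c = ∅ , now c
... | _ , inj₂ () , _
barred⇒AF (node g) {m} {C} bar = ∃AF-later λ d → barred⇒AF (g d) (barred-↾ d)
  where
  barred-↾ : ∀ d → BarredBy (g d) (suc (m + d)) (extend (m + d) C)
  barred-↾ d α with bar (cons d α)
  ... | zero  , _          , c    = 0 , inj₁ refl , inj₁ c
  ... | suc n , inj₁ ()    , _
  ... | suc n , inj₂ α̅n∈T , full = n , inj₂ α̅n∈T , full

almostFull⇒AF : BrouwersThesis → ∀ {C} → AlmostFull C → ∃ (AF 0 C)
almostFull⇒AF bt {C} af with bt (FullAfter 0 C) (almostFull⇒bar af)
... | T , T-bar = barred⇒AF T λ α → map₂ (map₁ inj₂) (T-bar α)

Border-∅⇒[] : ∀ {t} → Border ∅ t → t ≡ []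
Border-∅⇒[] {[]}    _           = refl
Border-∅⇒[] {x ∷ u} (_ , below) = ⊥-elim (below [] (x , u , refl))

border-root : ∀ U {X Y} → X [] → X ⊆ Border U → Y ⊆ Border U → Y ⊆ X
border-root ∅ x₀ _ Y⊆ t y with Border-∅⇒[] (Y⊆ t y)
... | refl = x₀
border-root (node _) x₀ X⊆ _ _ _ = ⊥-elim (proj₁ (X⊆ [] x₀) tt)

border-↾ : ∀ f a {A} → A ⊆ Border (node f) → A ↾ a ⊆ Border (f a)
border-↾ f a A⊆ t x with A⊆ (a ∷ t) x
... | a∷t∉ , below = a∷t∉ , λ { t′ (y , u , eq) → below (a ∷ t′) (y , u , cong (a ∷_) eq) }

intersect : ∀ U {SA SB m R A B} → A ⊆ Border U → B ⊆ Border U →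
            AF m (R ∪ A) SA → AF m (R ∪ B) SB → ∃ (AF m (R ∪ (A ∩ B)))

intersect-↾ : ∀ U a {SA SB n R A B} → A ⊆ Border U → B ⊆ Border U →
              AF n (R ∪ A ↾ a) SA → AF n (R ∪ B ↾ a) SB → ∃ (AF n (R ∪ (A ∩ B) ↾ a))

intersect U _ _ (now (inj₁ r)) _ = ∅ , now (inj₁ r)
intersect U A⊆ B⊆ (now (inj₂ a₀)) afB =
  -, AF-⊆ (∪-monoʳ λ t b → border-root U a₀ A⊆ B⊆ t b , b) afB
intersect U _ _ _ (now (inj₁ r)) = ∅ , now (inj₁ r)
intersect U A⊆ B⊆ afA (now (inj₂ b₀)) =
  -, AF-⊆ (∪-monoʳ λ t a → a , border-root U b₀ B⊆ A⊆ t a) afA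
intersect U {m = m} {R} {A} {B} A⊆ B⊆ afA@(later sA) afB@(later sB) = ∃AF-later step
  where
  step : ∀ d → ∃ (AF (suc (m + d)) (extend (m + d) (R ∪ (A ∩ B))))
  step d = map₂ (AF-⊆ extend-∪⁻)
                (intersect-↾ U a A⊆ B⊆ (AF-⊆ ∪-swap (proj₂ left)) (AF-⊆ ∪-swap (proj₂ right)))
    where
    a : ℕ
    a = m + d
    m≤a : m ≤ a
    m≤a = m≤m+n m d
    left : ∃ (AF (suc a) (extend a R ∪ A ↾ a ∪ (A ∩ B)))
    left = intersect U A⊆ B⊆ (AF-⊆ extend-∪ (sA a m≤a))
                             (AF-⊆ ∪-extend (AF-raise (m≤n⇒m≤1+n m≤a) afB))
    right : ∃ (AF (suc a) (extend a R ∪ B ↾ a ∪ (A ∩ B)))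
    right = intersect U A⊆ B⊆ (AF-⊆ ∪-extend (AF-raise (m≤n⇒m≤1+n m≤a) afA))
                              (AF-⊆ extend-∪ (sB a m≤a))

intersect-↾ ∅ a A⊆ _ afA _ =
  -, AF-⊆ (∪-monoʳ λ t x → contradiction (Border-∅⇒[] (A⊆ (a ∷ t) x)) λ ()) afA
intersect-↾ (node f) a A⊆ B⊆ afA afB = intersect (f a) (border-↾ f a A⊆) (border-↾ f a B⊆) afA afB

clopenRamsey : BrouwersThesis → ClopenRamsey
clopenRamsey bt U A B A⊆ B⊆ afA afB with almostFull⇒AF bt afA | almostFull⇒AF bt afB
... | _ , A-AF | _ , B-AF =
  AF⇒almostFull (AF-⊆ ∅-∪ (proj₂ (intersect U {R = ∅ᵘ} A⊆ B⊆ (AF-⊆ (λ _ → inj₂) A-AF)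
                                                               (AF-⊆ (λ _ → inj₂) B-AF))))

shorterThan : ℕ → Stump
shorterThan zero    = ∅
shorterThan (suc k) = node λ _ → shorterThan k

length<⇒∈shorterThan : ∀ k {t} → length t < k → t ∈S shorterThan k
length<⇒∈shorterThan zero    ()
length<⇒∈shorterThan (suc k) {[]}    _ = tt
length<⇒∈shorterThan (suc k) {_ ∷ _} l = length<⇒∈shorterThan k (s<s⁻¹ l)

length≡⇒∉shorterThan : ∀ k {t} → length t ≡ k → ¬ t ∈S shorterThan k
length≡⇒∉shorterThan zero    _ ()
length≡⇒∉shorterThan (suc k) {[]}    ()
length≡⇒∉shorterThan (suc k) {_ ∷ _} eq t∈ = length≡⇒∉shorterThan k (suc-injective eq) t∈

⊏⇒length< : ∀ {t s} → t ⊏ s → length t < length s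
⊏⇒length< {t} (_ , _ , refl) = subst (length t <_) (sym (length-++ t)) (m<m+n (length t) z<s)

length≡⇒Border : ∀ k {s} → length s ≡ k → Border (shorterThan k) s
length≡⇒Border k eq =
  length≡⇒∉shorterThan k eq , λ t t⊏s → length<⇒∈shorterThan k (subst (_ <_) eq (⊏⇒length< t⊏s))

theorem18p10 : BrouwersThesis → ClopenRamsey × InfiniteRamsey
theorem18p10 bt = clopenRamsey bt , λ k A B A⊆ B⊆ →
  clopenRamsey bt (shorterThan k) A B (λ s a → length≡⇒Border k (proj₂ (A⊆ s a)))
                                      (λ s b → length≡⇒Border k (proj₂ (B⊆ s b)))
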